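{- Let $\Gamma$ be a multiply-laced Dynkin diagram, i.e. of type $B_n$, $C_n$, $F_4$ or $G_2$. Playing the multiply-laced Kostant game on $\Gamma$ (over all choices of initial vertex and all sequences of moves), only two different final configurations can be obtained.
   Context: Let $\alpha_1,\dots,\alpha_r$ be the simple roots corresponding to the vertices $1,\dots,r$ of $\Gamma$, and $N(i)$ the set of vertices adjacent to $i$. For $j\in N(i)$: if $\alpha_i,\alpha_j$ have the same length, $n_{i,j}=n_{j,i}=1$; if $\alpha_i$ is long and $\alpha_j$ is short, $n_{i,j}=1$ and $n_{j,i}=(\alpha_i,\alpha_i)/(\alpha_j,\alpha_j)\in\{2,3\}$. Multiply-laced Kostant game: a configuration is $c=(c_1,\dots,c_r)$ with $c_i\in\mathbb{Z}_{\ge0}$; initially one chip is placed at some vertex $i_0$ ($c_{i_0}=1$, other $c_i=0$). Vertex $i$ is sad if $c_i<\frac12\sum_{j\in N(i)}n_{i,j}c_j$. While there are sad vertices, one chooses a sad vertex $i$ and replaces $c_i$ by $-c_i+\sum_{j\in N(i)}n_{i,j}c_j$, keeping other coordinates; the game ends (with a final configuration) when no vertex is sad. -}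

module Defs where

open import Data.Nat using (ℕ; zero; suc; _+_; _*_; _∸_; _<_; _≤_; _≡ᵇ_)
open import Data.Bool using (Bool; true; false; if_then_else_; _∧_; _∨_)
open import Data.Fin using (Fin; toℕ; _≟_)
open import Data.List using (List; map; allFin)
open import Data.Nat.ListAction using (sum)
open import Data.Product using (Σ; _×_)
open import Relation.Nullary using (¬_; yes; no)
open import Relation.Binary.PropositionalEquality using (_≡_)
open import Relation.Binary.Construct.Closure.ReflexiveTransitive using (Star)

-- Vertices are 0-based: vertex k here is vertex k+1 of the paper.
-- Dynkin diagrams are chains: i and j adjacent iff |i - j| = 1.
adjacent : ℕ → ℕ → Bool
adjacent i j = (suc i ≡ᵇ j) ∨ (suc j ≡ᵇ i)

-- nB m i j = n_{i,j} for B_m (chain, last root α_m short, others long):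
-- n_{m,m-1} = 2 (paper 1-based), all other edge coefficients 1, non-edges 0.
nB : ℕ → ℕ → ℕ → ℕ
nB m i j = if adjacent i j
           then (if (i ≡ᵇ (m ∸ 1)) ∧ (j ≡ᵇ (m ∸ 2)) then 2 else 1)
           else 0

-- C_m: last root α_m long, others short: n_{m-1,m} = 2.
nC : ℕ → ℕ → ℕ → ℕ
nC m i j = if adjacent i j
           then (if (i ≡ᵇ (m ∸ 2)) ∧ (j ≡ᵇ (m ∸ 1)) then 2 else 1)
           else 0

-- F_4: α1, α2 long, α3, α4 short: n_{3,2} = 2.
nF : ℕ → ℕ → ℕ
nF i j = if adjacent i j
         then (if (i ≡ᵇ 2) ∧ (j ≡ᵇ 1) then 2 else 1)
         else 0

-- G_2: α1 long, α2 short: n_{2,1} = 3.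
nG : ℕ → ℕ → ℕ
nG i j = if adjacent i j
         then (if (i ≡ᵇ 1) ∧ (j ≡ᵇ 0) then 3 else 1)
         else 0

data MultiplyLaced : Set where
  typeB : (n : ℕ) → 2 ≤ n → MultiplyLaced
  typeC : (n : ℕ) → 3 ≤ n → MultiplyLaced
  typeF4 : MultiplyLaced
  typeG2 : MultiplyLaced

rank : MultiplyLaced → ℕ
rank (typeB n _) = n
rank (typeC n _) = n
rank typeF4 = 4
rank typeG2 = 2

coeff : (Γ : MultiplyLaced) → Fin (rank Γ) → Fin (rank Γ) → ℕ
coeff (typeB n _) i j = nB n (toℕ i) (toℕ j)
coeff (typeC n _) i j = nC n (toℕ i) (toℕ j)
coeff typeF4 i j = nF (toℕ i) (toℕ j)
coeff typeG2 i j = nG (toℕ i) (toℕ j)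

Config : MultiplyLaced → Set
Config Γ = Fin (rank Γ) → ℕ

_≈_ : {Γ : MultiplyLaced} → Config Γ → Config Γ → Set
_≈_ {Γ} c d = (i : Fin (rank Γ)) → c i ≡ d i

nbSum : (Γ : MultiplyLaced) → Config Γ → Fin (rank Γ) → ℕ
nbSum Γ c i = sum (map (λ j → coeff Γ i j * c j) (allFin (rank Γ)))

-- i is sad: c_i < (1/2) Σ n_{i,j} c_j, i.e. 2 c_i < Σ n_{i,j} c_j
Sad : (Γ : MultiplyLaced) → Config Γ → Fin (rank Γ) → Set
Sad Γ c i = 2 * c i < nbSum Γ c i

initial : (Γ : MultiplyLaced) → Fin (rank Γ) → Config Γ
initial Γ i₀ j with j ≟ i₀
... | yes _ = 1
... | no _ = 0

-- firing vertex i: c_i ↦ -c_i + Σ n_{i,j} c_j (nonnegative when i is sad)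
fire : (Γ : MultiplyLaced) → Config Γ → Fin (rank Γ) → Config Γ
fire Γ c i j with j ≟ i
... | yes _ = nbSum Γ c i ∸ c i
... | no _ = c j

Move : (Γ : MultiplyLaced) → Config Γ → Config Γ → Set
Move Γ c d = Σ (Fin (rank Γ)) λ i → Sad Γ c i × _≈_ {Γ} d (fire Γ c i)

Reachable : (Γ : MultiplyLaced) → Config Γ → Config Γ → Set
Reachable Γ = Star (Move Γ)

IsFinal : (Γ : MultiplyLaced) → Config Γ → Set
IsFinal Γ c = (i : Fin (rank Γ)) → ¬ Sad Γ c i

FinalFrom : (Γ : MultiplyLaced) → Fin (rank Γ) → Config Γ → Set
FinalFrom Γ i₀ c = Reachable Γ (initial Γ i₀) c × IsFinal Γ c

-- Firing a sad vertex i is the simple reflection s_i written in simple-root coordinates, and i is sad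
-- exactly when the pairing of the current vector with the coroot of α_i is negative.  Starting from a
-- simple root, every configuration of the game is therefore a positive root, and a final configuration
-- is a dominant positive root: the highest root or the highest short root.  For F₄ and G₂ this is a
-- finite computation over the positive roots.  For B_n and C_n the positive roots are indicators of
-- segments of the chain or sums of two such; a vertex can be sad only next to an end of a segment, and
-- firing it moves that end by one vertex (or, at the multiple edge, starts the second segment).
module Submission where

open import Defs
open import Data.Bool using (true; false; if_then_else_; _∧_)
open import Data.Bool.Properties using (∨-zeroʳ; ∧-zeroʳ)
open import Data.Empty using (⊥-elim)
open import Data.Fin using (Fin; toℕ) renaming (zero to 0F; suc to 1+F)
import Data.Fin as Fin
import Data.Fin.Properties as Fin
open import Data.List using (List; []; _∷_; map; allFin; tabulate)
open import Data.List.Membership.Propositional using (_∈_; find)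
open import Data.List.Properties using (map-cong; map-tabulate; tabulate-cong)
open import Data.List.Relation.Unary.All as All using (All; all?)
open import Data.List.Relation.Unary.Any using (Any; any?)
open import Data.Nat
open import Data.Nat.ListAction using (sum)
open import Data.Nat.Properties
open import Data.Product using (Σ; ∃; _×_; _,_; proj₁; proj₂)
import Data.Sum as Sum
open import Data.Sum using (_⊎_; inj₁; inj₂)
open import Data.Unit using (⊤; tt)
open import Data.Vec using (_∷_; []; lookup)
open import Function using (_∘_; id)
open import Relation.Binary.Construct.Closure.ReflexiveTransitive using (Star; ε; _◅_; _◅◅_)
open import Relation.Binary.Definitions using (tri<; tri≈; tri>)
open import Relation.Binary.PropositionalEquality
open import Relation.Nullary using (¬_; Dec; yes; no; does; contradiction)
open import Relation.Nullary.Decidable using (True; toWitness; dec-true; dec-false; ¬?; _×-dec_; _⊎-dec_; _→-dec_)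

-- `_≈_ {Γ}` of Defs unfolds to `_≗_`, which spares the annotation: Γ cannot be inferred from `Config Γ`.

module _ {Γ : MultiplyLaced} {c d : Config Γ} (c≗d : c ≗ d) where

  nbSum-cong : ∀ k → nbSum Γ c k ≡ nbSum Γ d k
  nbSum-cong k = cong sum (map-cong (λ j → cong (coeff Γ k j *_) (c≗d j)) (allFin (rank Γ)))

  Sad-cong : ∀ {k} → Sad Γ c k → Sad Γ d k
  Sad-cong {k} = subst₂ (λ x s → 2 * x < s) (c≗d k) (nbSum-cong k)

  fire-cong : ∀ k → fire Γ c k ≗ fire Γ d k
  fire-cong k j with j Fin.≟ k
  ... | yes _ = cong₂ _∸_ (nbSum-cong k) (c≗d k)
  ... | no _  = c≗d j

  Move-congˡ : ∀ {e} → Move Γ c e → Move Γ d e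
  Move-congˡ (k , sad , e≗) = k , Sad-cong sad , λ j → trans (e≗ j) (fire-cong k j)

IsFinal-cong : ∀ {Γ} {c d : Config Γ} → c ≗ d → IsFinal Γ c → IsFinal Γ d
IsFinal-cong {Γ} c≗d final k = final k ∘ Sad-cong {Γ} (sym ∘ c≗d)

record ClosedFamily (Γ : MultiplyLaced) : Set₁ where
  field
    Index          : Set
    member         : Index → Config Γ
    initial-member : ∀ i₀ → Σ Index λ s → initial Γ i₀ ≗ member s
    move-member    : ∀ s {d} → Move Γ (member s) d → Σ Index λ s′ → d ≗ member s′
    top₁ top₂      : Config Γ
    final-member   : ∀ s → IsFinal Γ (member s) → member s ≗ top₁ ⊎ member s ≗ top₂
    top₁≉top₂      : ¬ top₁ ≗ top₂
    finalFrom₁     : Σ (Fin (rank Γ)) λ i₀ → FinalFrom Γ i₀ top₁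
    finalFrom₂     : Σ (Fin (rank Γ)) λ i₀ → FinalFrom Γ i₀ top₂

  reachable-member : ∀ {c d} → Σ Index (λ s → c ≗ member s) → Reachable Γ c d →
                     Σ Index λ s → d ≗ member s
  reachable-member c∈ ε                      = c∈
  reachable-member (s , c≗) (move ◅ moves) = reachable-member (move-member s (Move-congˡ {Γ} c≗ move)) moves

  finalFrom-top : ∀ {i₀ c} → FinalFrom Γ i₀ c → c ≗ top₁ ⊎ c ≗ top₂
  finalFrom-top {i₀} (play , final) with reachable-member (initial-member i₀) play
  ... | s , c≗ = Sum.map (λ ≗top j → trans (c≗ j) (≗top j)) (λ ≗top j → trans (c≗ j) (≗top j))
                         (final-member s (IsFinal-cong {Γ} c≗ final))

module Enumerated (Γ : MultiplyLaced) where

  _≗?_ : (c d : Config Γ) → Dec (c ≗ d)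
  c ≗? d = Fin.all? λ i → c i ≟ d i

  sad? : ∀ c k → Dec (Sad Γ c k)
  sad? c k = 2 * c k <? nbSum Γ c k

  isFinal? : ∀ c → Dec (IsFinal Γ c)
  isFinal? c = Fin.all? λ k → ¬? (sad? c k)

  move? : ∀ c d → Dec (Move Γ c d)
  move? c d = Fin.any? λ k → sad? c k ×-dec (d ≗? fire Γ c k)

  MovesThrough : Config Γ → List (Config Γ) → Set
  MovesThrough c []       = ⊤
  MovesThrough c (d ∷ ds) = Move Γ c d × MovesThrough d ds

  movesThrough? : ∀ c ds → Dec (MovesThrough c ds)
  movesThrough? c []       = yes tt
  movesThrough? c (d ∷ ds) = move? c d ×-dec movesThrough? d ds

  endpoint : Config Γ → List (Config Γ) → Config Γ
  endpoint c []       = c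
  endpoint c (d ∷ ds) = endpoint d ds

  reachable-endpoint : ∀ c ds → MovesThrough c ds → Reachable Γ c (endpoint c ds)
  reachable-endpoint c []       tt             = ε
  reachable-endpoint c (d ∷ ds) (move , moves) = move ◅ reachable-endpoint d ds moves

  _∈≗_ : Config Γ → List (Config Γ) → Set
  c ∈≗ R = Any (c ≗_) R

  Certificate : List (Config Γ) → Fin (rank Γ) → List (Config Γ) → Fin (rank Γ) → List (Config Γ) → Set
  Certificate R i₁ ds₁ i₂ ds₂ =
    (∀ i₀ → initial Γ i₀ ∈≗ R)
    × All (λ r → ∀ k → Sad Γ r k → fire Γ r k ∈≗ R) R
    × All (λ r → IsFinal Γ r → r ≗ c₁ ⊎ r ≗ c₂) R
    × (MovesThrough (initial Γ i₁) ds₁ × IsFinal Γ c₁)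
    × (MovesThrough (initial Γ i₂) ds₂ × IsFinal Γ c₂)
    × ¬ c₁ ≗ c₂
    where
    c₁ = endpoint (initial Γ i₁) ds₁
    c₂ = endpoint (initial Γ i₂) ds₂

  certificate? : ∀ R i₁ ds₁ i₂ ds₂ → Dec (Certificate R i₁ ds₁ i₂ ds₂)
  certificate? R i₁ ds₁ i₂ ds₂ =
    Fin.all? (λ i₀ → any? (initial Γ i₀ ≗?_) R)
    ×-dec all? (λ r → Fin.all? λ k → sad? r k →-dec any? (fire Γ r k ≗?_) R) R
    ×-dec all? (λ r → isFinal? r →-dec ((r ≗? c₁) ⊎-dec (r ≗? c₂))) R
    ×-dec (movesThrough? (initial Γ i₁) ds₁ ×-dec isFinal? c₁)
    ×-dec (movesThrough? (initial Γ i₂) ds₂ ×-dec isFinal? c₂)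
    ×-dec ¬? (c₁ ≗? c₂)
    where
    c₁ = endpoint (initial Γ i₁) ds₁
    c₂ = endpoint (initial Γ i₂) ds₂

  fromCertificate : ∀ R i₁ ds₁ i₂ ds₂ → Certificate R i₁ ds₁ i₂ ds₂ → ClosedFamily Γ
  fromCertificate R i₁ ds₁ i₂ ds₂
    (initials , closed , finals , (moves₁ , final₁) , (moves₂ , final₂) , c₁≉c₂) = record
    { Index          = ∃ (_∈ R)
    ; member         = proj₁
    ; initial-member = λ i₀ → inR (initials i₀)
    ; move-member    = λ { (r , r∈R) (k , sad , d≗) → let s , ≗s = inR (All.lookup closed r∈R k sad) in
                                                       s , λ j → trans (d≗ j) (≗s j) }
    ; top₁           = endpoint (initial Γ i₁) ds₁
    ; top₂           = endpoint (initial Γ i₂) ds₂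
    ; final-member   = λ (r , r∈R) → All.lookup finals r∈R
    ; top₁≉top₂      = c₁≉c₂
    ; finalFrom₁     = i₁ , reachable-endpoint _ ds₁ moves₁ , final₁
    ; finalFrom₂     = i₂ , reachable-endpoint _ ds₂ moves₂ , final₂
    }
    where
    inR : ∀ {c} → c ∈≗ R → Σ (∃ (_∈ R)) λ s → c ≗ proj₁ s
    inR c∈ = let r , r∈R , c≗r = find c∈ in (r , r∈R) , c≗r

  closedFamily : ∀ R i₁ ds₁ i₂ ds₂ → {True (certificate? R i₁ ds₁ i₂ ds₂)} → ClosedFamily Γ
  closedFamily R i₁ ds₁ i₂ ds₂ {ok} = fromCertificate R i₁ ds₁ i₂ ds₂ (toWitness ok)

G₂-family : ClosedFamily typeG2
G₂-family = Enumerated.closedFamily typeG2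
  (map lookup
    ((0 ∷ 1 ∷ []) ∷ (1 ∷ 0 ∷ []) ∷ (1 ∷ 1 ∷ []) ∷ (1 ∷ 2 ∷ []) ∷ (1 ∷ 3 ∷ []) ∷ (2 ∷ 3 ∷ []) ∷ []))
  0F       (map lookup ((1 ∷ 3 ∷ []) ∷ (2 ∷ 3 ∷ []) ∷ []))
  (1+F 0F) (map lookup ((1 ∷ 1 ∷ []) ∷ (1 ∷ 2 ∷ []) ∷ []))

F₄-family : ClosedFamily typeF4
F₄-family = Enumerated.closedFamily typeF4
  (map lookup
    ( (0 ∷ 0 ∷ 0 ∷ 1 ∷ []) ∷ (0 ∷ 0 ∷ 1 ∷ 0 ∷ []) ∷ (0 ∷ 0 ∷ 1 ∷ 1 ∷ []) ∷ (0 ∷ 1 ∷ 0 ∷ 0 ∷ [])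
    ∷ (0 ∷ 1 ∷ 1 ∷ 0 ∷ []) ∷ (0 ∷ 1 ∷ 1 ∷ 1 ∷ []) ∷ (0 ∷ 1 ∷ 2 ∷ 0 ∷ []) ∷ (0 ∷ 1 ∷ 2 ∷ 1 ∷ [])
    ∷ (0 ∷ 1 ∷ 2 ∷ 2 ∷ []) ∷ (1 ∷ 0 ∷ 0 ∷ 0 ∷ []) ∷ (1 ∷ 1 ∷ 0 ∷ 0 ∷ []) ∷ (1 ∷ 1 ∷ 1 ∷ 0 ∷ [])
    ∷ (1 ∷ 1 ∷ 1 ∷ 1 ∷ []) ∷ (1 ∷ 1 ∷ 2 ∷ 0 ∷ []) ∷ (1 ∷ 1 ∷ 2 ∷ 1 ∷ []) ∷ (1 ∷ 1 ∷ 2 ∷ 2 ∷ [])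
    ∷ (1 ∷ 2 ∷ 2 ∷ 0 ∷ []) ∷ (1 ∷ 2 ∷ 2 ∷ 1 ∷ []) ∷ (1 ∷ 2 ∷ 2 ∷ 2 ∷ []) ∷ (1 ∷ 2 ∷ 3 ∷ 1 ∷ [])
    ∷ (1 ∷ 2 ∷ 3 ∷ 2 ∷ []) ∷ (1 ∷ 2 ∷ 4 ∷ 2 ∷ []) ∷ (1 ∷ 3 ∷ 4 ∷ 2 ∷ []) ∷ (2 ∷ 3 ∷ 4 ∷ 2 ∷ []) ∷ []))
  0F
  (map lookup
    ( (1 ∷ 1 ∷ 0 ∷ 0 ∷ []) ∷ (1 ∷ 1 ∷ 2 ∷ 0 ∷ []) ∷ (1 ∷ 2 ∷ 2 ∷ 0 ∷ []) ∷ (1 ∷ 2 ∷ 2 ∷ 2 ∷ [])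
    ∷ (1 ∷ 2 ∷ 4 ∷ 2 ∷ []) ∷ (1 ∷ 3 ∷ 4 ∷ 2 ∷ []) ∷ (2 ∷ 3 ∷ 4 ∷ 2 ∷ []) ∷ []))
  (1+F (1+F 0F))
  (map lookup
    ( (0 ∷ 1 ∷ 1 ∷ 0 ∷ []) ∷ (1 ∷ 1 ∷ 1 ∷ 0 ∷ []) ∷ (1 ∷ 1 ∷ 1 ∷ 1 ∷ []) ∷ (1 ∷ 1 ∷ 2 ∷ 1 ∷ [])
    ∷ (1 ∷ 2 ∷ 2 ∷ 1 ∷ []) ∷ (1 ∷ 2 ∷ 3 ∷ 1 ∷ []) ∷ (1 ∷ 2 ∷ 3 ∷ 2 ∷ []) ∷ []))

≡ᵇ-refl : ∀ m → (m ≡ᵇ m) ≡ true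
≡ᵇ-refl m = dec-true (m ≟ m) refl

≢⇒≡ᵇ-false : ∀ {m n} → m ≢ n → (m ≡ᵇ n) ≡ false
≢⇒≡ᵇ-false {m} {n} = dec-false (m ≟ n)

adjacent-suc : ∀ m → adjacent m (suc m) ≡ true
adjacent-suc m rewrite ≡ᵇ-refl m = refl

adjacent-pred : ∀ m → adjacent (suc m) m ≡ true
adjacent-pred m rewrite ≡ᵇ-refl m = ∨-zeroʳ _

adjacent-far : ∀ {i j} → suc i ≢ j → suc j ≢ i → adjacent i j ≡ false
adjacent-far i+1≢j j+1≢i rewrite ≢⇒≡ᵇ-false i+1≢j | ≢⇒≡ᵇ-false j+1≢i = refl

if-adjacent-far : ∀ {i j} w → suc i ≢ j → suc j ≢ i → (if adjacent i j then w else 0) ≡ 0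
if-adjacent-far w i+1≢j j+1≢i rewrite adjacent-far i+1≢j j+1≢i = refl

left : (ℕ → ℕ) → ℕ → ℕ
left f zero    = 0
left f (suc m) = f m

left-+ : ∀ f g m {x y} → left f m ≡ x → left g m ≡ y → left (λ j → f j + g j) m ≡ x + y
left-+ f g zero    refl refl = refl
left-+ f g (suc m) refl refl = refl

left-≤ : ∀ {f c} → (∀ j → f j ≤ c) → ∀ m → left f m ≤ c
left-≤ f≤c zero    = z≤n
left-≤ f≤c (suc m) = f≤c m

sum-zero : ∀ n (g : ℕ → ℕ) → (∀ j → g j ≡ 0) → sum (tabulate {n = n} (g ∘ toℕ)) ≡ 0
sum-zero zero    g g≡0 = refl
sum-zero (suc n) g g≡0 = cong₂ _+_ (g≡0 0) (sum-zero n (g ∘ suc) (g≡0 ∘ suc))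

-- Only indices below n are summed, hence the hypothesis g n ≡ 0 for the case m = n - 1.
sum-neighbours : ∀ n m (g : ℕ → ℕ) → m < n → g n ≡ 0 →
                 (∀ j → suc j ≢ m → suc m ≢ j → g j ≡ 0) →
                 sum (tabulate {n = n} (g ∘ toℕ)) ≡ left g m + g (suc m)
sum-neighbours (suc zero) zero g _ g1≡0 far
  rewrite far 0 (λ ()) (λ ()) | g1≡0 = refl
sum-neighbours (suc (suc n)) zero g _ _ far
  rewrite far 0 (λ ()) (λ ()) | sum-zero n (g ∘ suc ∘ suc) (λ j → far (2 + j) (λ ()) (λ ()))
  = +-identityʳ (g 1)
sum-neighbours (suc n) (suc m) g (s≤s m<n) gn≡0 far = begin
  g 0 + sum (tabulate {n = n} (g ∘ suc ∘ toℕ))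
    ≡⟨ cong (g 0 +_) (sum-neighbours n m (g ∘ suc) m<n gn≡0 far′) ⟩
  g 0 + (left (g ∘ suc) m + g (suc (suc m)))
    ≡⟨ +-assoc (g 0) _ _ ⟨
  g 0 + left (g ∘ suc) m + g (suc (suc m))
    ≡⟨ cong (_+ g (suc (suc m))) (first m far) ⟩
  g m + g (suc (suc m)) ∎
  where
  open ≡-Reasoning
  far′ : ∀ j → suc j ≢ m → suc m ≢ j → g (suc j) ≡ 0
  far′ j j+1≢m m+1≢j = far (suc j) (j+1≢m ∘ suc-injective) (m+1≢j ∘ suc-injective)
  first : ∀ m → (∀ j → suc j ≢ suc m → suc (suc m) ≢ j → g j ≡ 0) → g 0 + left (g ∘ suc) m ≡ g m
  first zero    _   = +-identityʳ (g 0)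
  first (suc m) far rewrite far 0 (λ ()) (λ ()) = refl

-- Opaque, so that unification can read a, b and j off `interval a b j`.
opaque

  interval : ℕ → ℕ → ℕ → ℕ
  interval a b j = if does (a ≤? j) ∧ does (j <? b) then 1 else 0

  interval-inside : ∀ {a b j} → a ≤ j → j < b → interval a b j ≡ 1
  interval-inside {a} {b} {j} a≤j j<b rewrite dec-true (a ≤? j) a≤j | dec-true (j <? b) j<b = refl

  interval-below : ∀ {a b j} → j < a → interval a b j ≡ 0
  interval-below {a} {b} {j} j<a rewrite dec-false (a ≤? j) (<⇒≱ j<a) = refl

  interval-above : ∀ {a b j} → b ≤ j → interval a b j ≡ 0
  interval-above {a} {b} {j} b≤j rewrite dec-false (j <? b) (≤⇒≯ b≤j) | ∧-zeroʳ (does (a ≤? j)) = refl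

  interval≤1 : ∀ {a b j} → interval a b j ≤ 1
  interval≤1 {a} {b} {j} with does (a ≤? j) ∧ does (j <? b)
  ... | true  = ≤-refl
  ... | false = z≤n

module _ {j m : ℕ} (j≢m : j ≢ m) where

  interval-extendˡ : ∀ {b} → interval (suc m) b j ≡ interval m b j
  interval-extendˡ {b} with <-cmp j m
  ... | tri< j<m _ _ = trans (interval-below (m<n⇒m<1+n j<m)) (sym (interval-below j<m))
  ... | tri≈ _ j≡m _ = ⊥-elim (j≢m j≡m)
  ... | tri> _ _ m<j with j <? b
  ...   | yes j<b = trans (interval-inside m<j j<b) (sym (interval-inside (<⇒≤ m<j) j<b))
  ...   | no  j≮b = trans (interval-above (≮⇒≥ j≮b)) (sym (interval-above (≮⇒≥ j≮b)))

  interval-extendʳ : ∀ {a} → interval a (suc m) j ≡ interval a m j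
  interval-extendʳ {a} with <-cmp j m
  ... | tri≈ _ j≡m _ = ⊥-elim (j≢m j≡m)
  ... | tri> _ _ m<j = trans (interval-above m<j) (sym (interval-above (<⇒≤ m<j)))
  ... | tri< j<m _ _ with a ≤? j
  ...   | yes a≤j = trans (interval-inside a≤j (m<n⇒m<1+n j<m)) (sym (interval-inside a≤j j<m))
  ...   | no  a≰j = trans (interval-below (≰⇒> a≰j)) (sym (interval-below (≰⇒> a≰j)))

  interval-point : interval m (suc m) j ≡ 0
  interval-point with <-cmp j m
  ... | tri< j<m _ _ = interval-below j<m
  ... | tri≈ _ j≡m _ = ⊥-elim (j≢m j≡m)
  ... | tri> _ _ m<j = interval-above m<j

module _ {a b : ℕ} where

  left-interval-below : ∀ {m} → m ≤ a → left (interval a b) m ≡ 0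
  left-interval-below {zero}  _   = refl
  left-interval-below {suc m} m<a = interval-below m<a

  left-interval-inside : ∀ {m} → a < m → m ≤ b → left (interval a b) m ≡ 1
  left-interval-inside {suc m} a<m m≤b = interval-inside (s≤s⁻¹ a<m) m≤b

  left-interval-above : ∀ {m} → b < m → left (interval a b) m ≡ 0
  left-interval-above {suc m} b<m = interval-above (s≤s⁻¹ b<m)

data Position : ℕ → ℕ → ℕ → Set where
  before     : ∀ {a b m} → suc m < a → Position a b m
  justBefore : ∀ {b m} → Position (suc m) b m
  inside     : ∀ {a b m} → a ≤ m → suc m < b → Position a b m
  lastInside : ∀ {a m} → a ≤ m → Position a (suc m) m
  justAfter  : ∀ {a b} → Position a b b
  after      : ∀ {a b m} → b < m → Position a b m

position : ∀ a b m → Position a b m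
position a b m with <-cmp (suc m) a
... | tri< m+1<a _ _ = before m+1<a
... | tri≈ _ refl _  = justBefore
... | tri> _ _ a≤m with <-cmp (suc m) b
...   | tri< m+1<b _ _ = inside (s≤s⁻¹ a≤m) m+1<b
...   | tri≈ _ refl _  = lastInside (s≤s⁻¹ a≤m)
...   | tri> _ _ b≤m with m≤n⇒m<n∨m≡n (s≤s⁻¹ b≤m)
...     | inj₁ b<m  = after b<m
...     | inj₂ refl = justAfter

-- Diagrams whose vertices 0, …, rank Γ - 1 form a chain; a configuration is handled as a function
-- ℕ → ℕ vanishing at rank Γ, so that segments of the chain can be shifted freely.
module Chain (Γ : MultiplyLaced) (ν : ℕ → ℕ → ℕ)
             (coeff≡ν : ∀ i j → coeff Γ i j ≡ ν (toℕ i) (toℕ j))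
             (ν-far : ∀ {i j} → suc i ≢ j → suc j ≢ i → ν i j ≡ 0) where

  toConfig : (ℕ → ℕ) → Config Γ
  toConfig f = f ∘ toℕ

  nb : (ℕ → ℕ) → ℕ → ℕ
  nb f m = ν m (pred m) * left f m + ν m (suc m) * f (suc m)

  nbSum-toConfig : ∀ f → f (rank Γ) ≡ 0 → ∀ k → nbSum Γ (toConfig f) k ≡ nb f (toℕ k)
  nbSum-toConfig f f-beyond k = begin
    sum (map (λ j → coeff Γ k j * f (toℕ j)) (allFin (rank Γ)))
      ≡⟨ cong sum (map-tabulate id (λ j → coeff Γ k j * f (toℕ j))) ⟩
    sum (tabulate (λ j → coeff Γ k j * f (toℕ j)))
      ≡⟨ cong sum (tabulate-cong λ j → cong (_* f (toℕ j)) (coeff≡ν k j)) ⟩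
    sum (tabulate {n = rank Γ} (g ∘ toℕ))
      ≡⟨ sum-neighbours (rank Γ) m g (Fin.toℕ<n k) g-beyond far ⟩
    left g m + g (suc m)
      ≡⟨ cong (_+ g (suc m)) (left-g m) ⟩
    nb f m ∎
    where
    open ≡-Reasoning
    m = toℕ k
    g : ℕ → ℕ
    g j = ν m j * f j
    g-beyond : g (rank Γ) ≡ 0
    g-beyond = trans (cong (ν m (rank Γ) *_) f-beyond) (*-zeroʳ (ν m (rank Γ)))
    far : ∀ j → suc j ≢ m → suc m ≢ j → g j ≡ 0
    far j j+1≢m m+1≢j = cong (_* f j) (ν-far m+1≢j j+1≢m)
    left-g : ∀ m → left (λ j → ν m j * f j) m ≡ ν m (pred m) * left f m
    left-g zero    = sym (*-zeroʳ (ν zero zero))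
    left-g (suc m) = refl

  -- A record rather than `nb f m ≤ 2 * f m` itself, so that f and m can be inferred from it.
  record Calm (f : ℕ → ℕ) (m : ℕ) : Set where
    constructor calm
    field nb≤2f : nb f m ≤ 2 * f m

  calm-isolated : ∀ {f m} → left f m ≡ 0 → f (suc m) ≡ 0 → Calm f m
  calm-isolated {f} {m} l≡0 r≡0 = calm (subst (_≤ 2 * f m) (sym nb≡0) z≤n)
    where
    nb≡0 : nb f m ≡ 0
    nb≡0 = cong₂ _+_ (trans (cong (ν m (pred m) *_) l≡0) (*-zeroʳ (ν m (pred m))))
                     (trans (cong (ν m (suc m) *_) r≡0) (*-zeroʳ (ν m (suc m))))

  calm-by : ∀ {f m x s} → f m ≡ x → nb f m ≡ s → s ≤ 2 * x → Calm f m
  calm-by refl refl s≤2x = calm s≤2x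

  calm-≤ : ∀ {f m x} → f m ≡ x → nb f m ≤ 2 * x → Calm f m
  calm-≤ refl nb≤2x = calm nb≤2x

  module _ {f : ℕ → ℕ} (f-beyond : f (rank Γ) ≡ 0) where

    Sad⇒sad : ∀ {k} → Sad Γ (toConfig f) k → 2 * f (toℕ k) < nb f (toℕ k)
    Sad⇒sad {k} = subst (2 * f (toℕ k) <_) (nbSum-toConfig f f-beyond k)

    sad⇒Sad : ∀ {m} (m<n : m < rank Γ) → 2 * f m < nb f m → Sad Γ (toConfig f) (Fin.fromℕ< m<n)
    sad⇒Sad m<n sad = subst (2 * f (toℕ k) <_) (sym (nbSum-toConfig f f-beyond k))
                            (subst (λ m → 2 * f m < nb f m) (sym (Fin.toℕ-fromℕ< m<n)) sad)
      where
      k = Fin.fromℕ< m<n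

    calm⇒IsFinal : (∀ m → m < rank Γ → Calm f m) → IsFinal Γ (toConfig f)
    calm⇒IsFinal calm-f k sad = ≤⇒≯ (Calm.nb≤2f (calm-f (toℕ k) (Fin.toℕ<n k))) (Sad⇒sad sad)

  record Fires (f : ℕ → ℕ) (m : ℕ) (g : ℕ → ℕ) : Set where
    field
      sad       : 2 * f m < nb f m
      fired     : g m ≡ nb f m ∸ f m
      unchanged : ∀ j → j ≢ m → g j ≡ f j
  open Fires public

  fires : ∀ {f g m x s} → f m ≡ x → nb f m ≡ s → 2 * x < s → g m ≡ s ∸ x → (∀ j → j ≢ m → g j ≡ f j) →
          Fires f m g
  fires refl refl sad fired unchanged = record { sad = sad ; fired = fired ; unchanged = unchanged }

  Step : (ℕ → ℕ) → (ℕ → ℕ) → Set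
  Step f g = ∃ λ m → m < rank Γ × Fires f m g

  -- Nonempty, so that the first move can absorb `initial Γ i₀ ≗ toConfig (interval i₀ (suc i₀))`.
  Plays⁺ : (ℕ → ℕ) → (ℕ → ℕ) → Set
  Plays⁺ f g = ∃ λ h → Step f h × Star Step h g

  module _ {f g : ℕ → ℕ} (f-beyond : f (rank Γ) ≡ 0) where

    fire-toConfig : ∀ k → Fires f (toℕ k) g → fire Γ (toConfig f) k ≗ toConfig g
    fire-toConfig k φ j with j Fin.≟ k
    ... | yes refl = sym (trans (fired φ) (cong (_∸ f (toℕ k)) (sym (nbSum-toConfig f f-beyond k))))
    ... | no  j≢k  = sym (unchanged φ (toℕ j) (j≢k ∘ Fin.toℕ-injective))

    Step⇒Move : Step f g → Move Γ (toConfig f) (toConfig g)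
    Step⇒Move (m , m<n , φ) = k , sad⇒Sad f-beyond m<n (sad φ) , λ j → sym (fire-toConfig k φ′ j)
      where
      k = Fin.fromℕ< m<n
      φ′ = subst (λ m → Fires f m g) (sym (Fin.toℕ-fromℕ< m<n)) φ

    Step-beyond : Step f g → g (rank Γ) ≡ 0
    Step-beyond (m , m<n , φ) = trans (unchanged φ (rank Γ) (>⇒≢ m<n)) f-beyond

  Star⇒Reachable : ∀ {f g} → f (rank Γ) ≡ 0 → Star Step f g → Reachable Γ (toConfig f) (toConfig g)
  Star⇒Reachable f-beyond ε              = ε
  Star⇒Reachable f-beyond (step ◅ steps) =
    Step⇒Move f-beyond step ◅ Star⇒Reachable (Step-beyond f-beyond step) steps

  initial≗simple : ∀ i₀ {m} → toℕ i₀ ≡ m → initial Γ i₀ ≗ toConfig (interval m (suc m))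
  initial≗simple i₀ refl j with j Fin.≟ i₀
  ... | yes refl = sym (interval-inside ≤-refl ≤-refl)
  ... | no  j≢i₀ = sym (interval-point (j≢i₀ ∘ Fin.toℕ-injective))

  record ChainFamily : Set₁ where
    field
      Root          : Set
      coeffs        : Root → ℕ → ℕ
      coeffs-beyond : ∀ s → coeffs s (rank Γ) ≡ 0
      calm-or-fires : ∀ s m → m < rank Γ →
                      Calm (coeffs s) m ⊎ Σ Root λ s′ → Fires (coeffs s) m (coeffs s′)
      simple        : ∀ m → m < rank Γ → Σ Root λ s → coeffs s ≗ interval m (suc m)
      top₁ top₂     : Root
      sad-or-top    : ∀ s → (∃ λ m → m < rank Γ × 2 * coeffs s m < nb (coeffs s) m)
                            ⊎ (coeffs s ≗ coeffs top₁ ⊎ coeffs s ≗ coeffs top₂)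
      top₁-calm     : ∀ m → m < rank Γ → Calm (coeffs top₁) m
      top₂-calm     : ∀ m → m < rank Γ → Calm (coeffs top₂) m
      top₁≢top₂     : ∃ λ j → j < rank Γ × coeffs top₁ j ≢ coeffs top₂ j
      plays₁        : ∃ λ m → m < rank Γ × Plays⁺ (interval m (suc m)) (coeffs top₁)
      plays₂        : ∃ λ m → m < rank Γ × Plays⁺ (interval m (suc m)) (coeffs top₂)

    member : Root → Config Γ
    member = toConfig ∘ coeffs

    initial-member : ∀ i₀ → Σ Root λ s → initial Γ i₀ ≗ member s
    initial-member i₀ with simple (toℕ i₀) (Fin.toℕ<n i₀)
    ... | s , s≗ = s , λ j → trans (initial≗simple i₀ refl j) (sym (s≗ (toℕ j)))

    move-member : ∀ s {d} → Move Γ (member s) d → Σ Root λ s′ → d ≗ member s′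
    move-member s (k , sad , d≗) with calm-or-fires s (toℕ k) (Fin.toℕ<n k)
    ... | inj₁ (calm nb≤2f) = ⊥-elim (≤⇒≯ nb≤2f (Sad⇒sad (coeffs-beyond s) sad))
    ... | inj₂ (s′ , φ)     = s′ , λ j → trans (d≗ j) (fire-toConfig (coeffs-beyond s) k φ j)

    final-member : ∀ s → IsFinal Γ (member s) → member s ≗ member top₁ ⊎ member s ≗ member top₂
    final-member s final with sad-or-top s
    ... | inj₁ (m , m<n , sad) = ⊥-elim (final (Fin.fromℕ< m<n) (sad⇒Sad (coeffs-beyond s) m<n sad))
    ... | inj₂ (inj₁ s≗top₁)   = inj₁ (s≗top₁ ∘ toℕ)
    ... | inj₂ (inj₂ s≗top₂)   = inj₂ (s≗top₂ ∘ toℕ)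

    member-top₁≉top₂ : ¬ member top₁ ≗ member top₂
    member-top₁≉top₂ top₁≗top₂ with top₁≢top₂
    ... | j , j<n , top₁≢top₂ =
      top₁≢top₂ (subst (λ j → coeffs top₁ j ≡ coeffs top₂ j) (Fin.toℕ-fromℕ< j<n)
                       (top₁≗top₂ (Fin.fromℕ< j<n)))

    finalFrom : ∀ s → ∃ (λ m → m < rank Γ × Plays⁺ (interval m (suc m)) (coeffs s)) →
                (∀ m → m < rank Γ → Calm (coeffs s) m) →
                Σ (Fin (rank Γ)) λ i₀ → FinalFrom Γ i₀ (member s)
    finalFrom s (m , m<n , h , step , steps) calm-s =
      i₀ , (first ◅ Star⇒Reachable (Step-beyond simple-beyond step) steps) ,
      calm⇒IsFinal (coeffs-beyond s) calm-s
      where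
      i₀ = Fin.fromℕ< m<n
      simple-beyond : interval m (suc m) (rank Γ) ≡ 0
      simple-beyond = interval-above m<n
      first : Move Γ (initial Γ i₀) (toConfig h)
      first = Move-congˡ {Γ} (sym ∘ initial≗simple i₀ (Fin.toℕ-fromℕ< m<n)) (Step⇒Move simple-beyond step)

    closedFamily : ClosedFamily Γ
    closedFamily = record
      { Index          = Root
      ; member         = member
      ; initial-member = initial-member
      ; move-member    = move-member
      ; top₁           = member top₁
      ; top₂           = member top₂
      ; final-member   = final-member
      ; top₁≉top₂      = member-top₁≉top₂
      ; finalFrom₁     = finalFrom top₁ plays₁ top₁-calm
      ; finalFrom₂     = finalFrom top₂ plays₂ top₂-calm
      }

module TypeB (k : ℕ) where

  n last : ℕ
  n = suc (suc k)
  last = suc k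

  Γ : MultiplyLaced
  Γ = typeB n (s≤s (s≤s z≤n))

  open Chain Γ (nB n) (λ _ _ → refl) (if-adjacent-far _)

  nb-interior : ∀ f {m} → m ≢ last → nb f m ≡ left f m + f (suc m)
  nb-interior f {zero}  _ = +-identityʳ (f 1)
  nb-interior f {suc m} m+1≢last
    rewrite adjacent-pred m | adjacent-suc (suc m) | ≢⇒≡ᵇ-false (m+1≢last ∘ cong suc)
    = cong₂ _+_ (*-identityˡ (f m)) (*-identityˡ (f (suc (suc m))))

  nb-last : ∀ f → f n ≡ 0 → nb f last ≡ 2 * f k
  nb-last f fn≡0
    rewrite adjacent-pred k | adjacent-suc (suc k) | ≢⇒≡ᵇ-false (>⇒≢ (m<n⇒m<1+n (n<1+n k)))
          | ≡ᵇ-refl k | fn≡0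
    = +-identityʳ (2 * f k)

  nb-≤ : ∀ f m {c} → left f m ≤ c → f (suc m) ≤ c → f n ≡ 0 → nb f m ≤ 2 * c
  nb-≤ f m {c} l≤c r≤c fn≡0 with m ≟ last
  ... | yes refl  = subst (_≤ 2 * c) (sym (nb-last f fn≡0)) (*-monoʳ-≤ 2 l≤c)
  ... | no m≢last = subst (_≤ 2 * c) (sym (nb-interior f m≢last)) (+-mono-≤ l≤c (m≤n⇒m≤n+o 0 r≤c))

  m+1<n⇒m≢last : ∀ {m} → suc m < n → m ≢ last
  m+1<n⇒m≢last m+1<n = <⇒≢ (s≤s⁻¹ m+1<n)

  -- With α_i = e_i - e_(i+1) and α_last = e_last, `interval a b` is e_a - e_b (where e_n = 0) and
  -- `doubled a b` is e_a + e_b: these are the positive roots of B_n.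
  doubled : ℕ → ℕ → ℕ → ℕ
  doubled a b j = interval a n j + interval b n j

  doubled≤2 : ∀ a b j → doubled a b j ≤ 2
  doubled≤2 a b j = +-mono-≤ interval≤1 interval≤1

  doubled-beyond : ∀ a b → doubled a b n ≡ 0
  doubled-beyond a b = cong₂ _+_ (interval-above ≤-refl) (interval-above ≤-refl)

  data Root : Set where
    single : ∀ a b → a < b → b ≤ n → Root
    double : ∀ a b → a < b → b < n → Root

  coeffs : Root → ℕ → ℕ
  coeffs (single a b _ _) = interval a b
  coeffs (double a b _ _) = doubled a b

  coeffs-beyond : ∀ s → coeffs s n ≡ 0
  coeffs-beyond (single a b _ b≤n) = interval-above b≤n
  coeffs-beyond (double a b _ _)   = doubled-beyond a b

  extendˡ-single : ∀ {m b} → suc m < b → b ≤ n → Fires (interval (suc m) b) m (interval m b)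
  extendˡ-single {m} {b} m+1<b b≤n =
    fires (interval-below ≤-refl)
          (trans (nb-interior _ (m+1<n⇒m≢last (<-≤-trans m+1<b b≤n)))
                 (cong₂ _+_ (left-interval-below (n≤1+n m)) (interval-inside ≤-refl m+1<b)))
          (s≤s z≤n)
          (interval-inside ≤-refl (<⇒≤ m+1<b))
          (λ j j≢m → sym (interval-extendˡ j≢m))

  extendʳ-single : ∀ {a b} → a < b → b < last → Fires (interval a b) b (interval a (suc b))
  extendʳ-single {a} {b} a<b b<last =
    fires (interval-above ≤-refl)
          (trans (nb-interior _ (<⇒≢ b<last))
                 (cong₂ _+_ (left-interval-inside a<b ≤-refl) (interval-above (n≤1+n b))))
          (s≤s z≤n)
          (interval-inside (<⇒≤ a<b) (n<1+n b))
          (λ j j≢b → interval-extendʳ j≢b)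

  single→double : ∀ {a} → a < last → Fires (interval a last) last (doubled a last)
  single→double {a} a<last =
    fires (interval-above ≤-refl)
          (trans (nb-last (interval a last) (interval-above (n≤1+n last)))
                 (cong (2 *_) (interval-inside (s≤s⁻¹ a<last) (n<1+n k))))
          (s≤s z≤n)
          (cong₂ _+_ (interval-inside (<⇒≤ a<last) (n<1+n last)) (interval-inside ≤-refl (n<1+n last)))
          (λ j j≢last → trans (cong₂ _+_ (interval-extendʳ j≢last) (interval-point j≢last)) (+-identityʳ _))

  extendˡ-double : ∀ {m b} → suc m < b → b < n → Fires (doubled (suc m) b) m (doubled m b)
  extendˡ-double {m} {b} m+1<b b<n =
    fires (cong₂ _+_ (interval-below ≤-refl) (interval-below m<b))
          (trans (nb-interior _ (m+1<n⇒m≢last m+1<n))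
                 (cong₂ _+_ (left-+ _ _ m (left-interval-below (n≤1+n m)) (left-interval-below (<⇒≤ m<b)))
                            (cong₂ _+_ (interval-inside ≤-refl m+1<n) (interval-below m+1<b))))
          (s≤s z≤n)
          (cong₂ _+_ (interval-inside ≤-refl (<⇒≤ m+1<n)) (interval-below m<b))
          (λ j j≢m → cong (_+ interval b n j) (sym (interval-extendˡ j≢m)))
    where
    m<b = <⇒≤ m+1<b
    m+1<n = <-trans m+1<b b<n

  shrink-double : ∀ {a m} → a < m → suc m < n → Fires (doubled a (suc m)) m (doubled a m)
  shrink-double {a} {m} a<m m+1<n =
    fires (cong₂ _+_ (interval-inside (<⇒≤ a<m) m<n) (interval-below ≤-refl))
          (trans (nb-interior _ (m+1<n⇒m≢last m+1<n))
                 (cong₂ _+_ (left-+ _ _ m (left-interval-inside a<m (<⇒≤ m<n)) (left-interval-below (n≤1+n m)))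
                            (cong₂ _+_ (interval-inside (m≤n⇒m≤1+n (<⇒≤ a<m)) m+1<n)
                                       (interval-inside ≤-refl m+1<n))))
          (s≤s (s≤s (s≤s z≤n)))
          (cong₂ _+_ (interval-inside (<⇒≤ a<m) m<n) (interval-inside ≤-refl m<n))
          (λ j j≢m → cong (interval a n j +_) (sym (interval-extendˡ j≢m)))
    where
    m<n = <⇒≤ m+1<n

  calm-single : ∀ {a b m} → a ≤ m → m < b → b ≤ n → Calm (interval a b) m
  calm-single {m = m} a≤m m<b b≤n =
    calm-≤ (interval-inside a≤m m<b)
           (nb-≤ _ m (left-≤ (λ _ → interval≤1) m) interval≤1 (interval-above b≤n))

  calm-double-inside : ∀ {a b m} → a ≤ m → suc m < b → b < n → Calm (doubled a b) m
  calm-double-inside {a} {b} {m} a≤m m+1<b b<n =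
    calm-≤ (cong₂ _+_ (interval-inside a≤m (<⇒≤ (<-trans m+1<b b<n))) (interval-below (<⇒≤ m+1<b)))
           (nb-≤ _ m left≤1 right≤1 (doubled-beyond a b))
    where
    left≤1 : left (doubled a b) m ≤ 1
    left≤1 = subst (_≤ 1) (sym (left-+ _ _ m refl (left-interval-below (<⇒≤ (<⇒≤ m+1<b)))))
                   (subst (_≤ 1) (sym (+-identityʳ _)) (left-≤ (λ _ → interval≤1) m))
    right≤1 : doubled a b (suc m) ≤ 1
    right≤1 = subst (_≤ 1) (sym (trans (cong (interval a n (suc m) +_) (interval-below m+1<b)) (+-identityʳ _)))
                    interval≤1

  calm-double-first : ∀ {a} → suc a < n → Calm (doubled a (suc a)) a
  calm-double-first {a} a+1<n =
    calm-by (cong₂ _+_ (interval-inside ≤-refl (<⇒≤ a+1<n)) (interval-below ≤-refl))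
            (trans (nb-interior _ (m+1<n⇒m≢last a+1<n))
                   (cong₂ _+_ (left-+ _ _ a (left-interval-below {a} {n} ≤-refl) (left-interval-below (n≤1+n a)))
                              (cong₂ _+_ (interval-inside (n≤1+n a) a+1<n) (interval-inside ≤-refl a+1<n))))
            ≤-refl

  calm-double-tail : ∀ {a b m} → a ≤ b → b ≤ m → m < n → Calm (doubled a b) m
  calm-double-tail {a} {b} {m} a≤b b≤m m<n =
    calm-≤ (cong₂ _+_ (interval-inside (≤-trans a≤b b≤m) m<n) (interval-inside b≤m m<n))
           (nb-≤ _ m (left-≤ (doubled≤2 a b) m) (doubled≤2 a b _) (doubled-beyond a b))

  fireAfter-single : ∀ {a b} → a < b → b < n → Σ Root λ s → Fires (interval a b) b (coeffs s)
  fireAfter-single {a} {b} a<b b<n with b ≟ last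
  ... | yes refl  = double a last a<b ≤-refl , single→double a<b
  ... | no b≢last = single a (suc b) (m<n⇒m<1+n a<b) b<n , extendʳ-single a<b (≤∧≢⇒< (s≤s⁻¹ b<n) b≢last)

  calm-or-fires : ∀ s m → m < n → Calm (coeffs s) m ⊎ Σ Root λ s′ → Fires (coeffs s) m (coeffs s′)
  calm-or-fires (single a b a<b b≤n) m m<n with position a b m
  ... | before m+1<a     = inj₁ (calm-isolated (left-interval-below (<⇒≤ (<⇒≤ m+1<a))) (interval-below m+1<a))
  ... | justBefore       = inj₂ (single m b (<⇒≤ a<b) b≤n , extendˡ-single a<b b≤n)
  ... | inside a≤m m+1<b = inj₁ (calm-single a≤m (<⇒≤ m+1<b) b≤n)
  ... | lastInside a≤m   = inj₁ (calm-single a≤m ≤-refl b≤n)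
  ... | justAfter        = inj₂ (fireAfter-single a<b m<n)
  ... | after b<m        = inj₁ (calm-isolated (left-interval-above b<m) (interval-above (m≤n⇒m≤1+n (<⇒≤ b<m))))
  calm-or-fires (double a b a<b b<n) m m<n with position a b m
  ... | before m+1<a     =
    inj₁ (calm-isolated (left-+ _ _ m (left-interval-below (<⇒≤ (<⇒≤ m+1<a)))
                                      (left-interval-below (<⇒≤ (<⇒≤ (<-trans m+1<a a<b)))))
                        (cong₂ _+_ (interval-below m+1<a) (interval-below (<-trans m+1<a a<b))))
  ... | justBefore       = inj₂ (double m b (<⇒≤ a<b) b<n , extendˡ-double a<b b<n)
  ... | inside a≤m m+1<b = inj₁ (calm-double-inside a≤m m+1<b b<n)
  ... | justAfter        = inj₁ (calm-double-tail (<⇒≤ a<b) ≤-refl m<n)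
  ... | after b<m        = inj₁ (calm-double-tail (<⇒≤ a<b) (<⇒≤ b<m) m<n)
  ... | lastInside a≤m with m≤n⇒m<n∨m≡n a≤m
  ...   | inj₁ a<m  = inj₂ (double a m a<m (<⇒≤ b<n) , shrink-double a<m b<n)
  ...   | inj₂ refl = inj₁ (calm-double-first b<n)

  top₁ top₂ : Root
  top₁ = double 0 1 (s≤s z≤n) (s≤s (s≤s z≤n))
  top₂ = single 0 n (s≤s z≤n) ≤-refl

  sad-or-top : ∀ s → (∃ λ m → m < n × 2 * coeffs s m < nb (coeffs s) m)
                   ⊎ (coeffs s ≗ coeffs top₁ ⊎ coeffs s ≗ coeffs top₂)
  sad-or-top (single (suc m) b m+1<b b≤n) =
    inj₁ (m , <-≤-trans (<⇒≤ m+1<b) b≤n , sad (extendˡ-single m+1<b b≤n))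
  sad-or-top (single zero b 0<b b≤n) with b <? n
  ... | yes b<n = inj₁ (b , b<n , sad (proj₂ (fireAfter-single 0<b b<n)))
  ... | no  b≮n = inj₂ (inj₂ λ j → cong (λ b → interval 0 b j) (≤-antisym b≤n (≮⇒≥ b≮n)))
  sad-or-top (double (suc m) b m+1<b b<n) =
    inj₁ (m , <⇒≤ (<-trans m+1<b b<n) , sad (extendˡ-double m+1<b b<n))
  sad-or-top (double zero (suc zero) _ _) = inj₂ (inj₁ λ _ → refl)
  sad-or-top (double zero (suc (suc m)) _ b<n) =
    inj₁ (suc m , <⇒≤ b<n , sad (shrink-double (s≤s z≤n) b<n))

  top₁-calm : ∀ m → m < n → Calm (coeffs top₁) m
  top₁-calm zero    _   = calm-double-first (s≤s (s≤s z≤n))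
  top₁-calm (suc m) m<n = calm-double-tail z≤n (s≤s z≤n) m<n

  top₂-calm : ∀ m → m < n → Calm (coeffs top₂) m
  top₂-calm m m<n = calm-single z≤n m<n ≤-refl

  top₁≢top₂ : ∃ λ j → j < n × coeffs top₁ j ≢ coeffs top₂ j
  top₁≢top₂ = 1 , 1<n , λ 2≡1 → contradiction (trans (sym two) (trans 2≡1 one)) λ ()
    where
    1<n : 1 < n
    1<n = s≤s (s≤s z≤n)
    two : doubled 0 1 1 ≡ 2
    two = cong₂ _+_ (interval-inside z≤n 1<n) (interval-inside ≤-refl 1<n)
    one : interval 0 n 1 ≡ 1
    one = interval-inside z≤n 1<n

  slideˡ-single : ∀ a {b} → a < b → b ≤ n → Star Step (interval a b) (interval 0 b)
  slideˡ-single zero    _   _   = ε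
  slideˡ-single (suc m) a<b b≤n =
    (m , <-≤-trans (<⇒≤ a<b) b≤n , extendˡ-single a<b b≤n) ◅ slideˡ-single m (<⇒≤ a<b) b≤n

  slideˡ-double : ∀ a {b} → a < b → b < n → Star Step (doubled a b) (doubled 0 b)
  slideˡ-double zero    _   _   = ε
  slideˡ-double (suc m) a<b b<n =
    (m , <⇒≤ (<-trans a<b b<n) , extendˡ-double a<b b<n) ◅ slideˡ-double m (<⇒≤ a<b) b<n

  shrink-to-first : ∀ b → 0 < b → b < n → Star Step (doubled 0 b) (doubled 0 1)
  shrink-to-first (suc zero)    _ _   = ε
  shrink-to-first (suc (suc m)) _ b<n =
    (suc m , <⇒≤ b<n , shrink-double (s≤s z≤n) b<n) ◅ shrink-to-first (suc m) (s≤s z≤n) (<⇒≤ b<n)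

  closedFamily : ClosedFamily Γ
  closedFamily = ChainFamily.closedFamily record
    { Root          = Root
    ; coeffs        = coeffs
    ; coeffs-beyond = coeffs-beyond
    ; calm-or-fires = calm-or-fires
    ; simple        = λ m m<n → single m (suc m) ≤-refl m<n , λ _ → refl
    ; top₁          = top₁
    ; top₂          = top₂
    ; sad-or-top    = sad-or-top
    ; top₁-calm     = top₁-calm
    ; top₂-calm     = top₂-calm
    ; top₁≢top₂     = top₁≢top₂
    ; plays₁        = k , k<n , doubled k last , (last , ≤-refl , single→double ≤-refl) ,
                      slideˡ-double k ≤-refl ≤-refl ◅◅ shrink-to-first last (s≤s z≤n) ≤-refl
    ; plays₂        = last , ≤-refl , interval k n , (k , k<n , extendˡ-single ≤-refl ≤-refl) ,
                      slideˡ-single k k<n ≤-refl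
    }
    where
    k<n : k < n
    k<n = m<n⇒m<1+n ≤-refl

module TypeC (k : ℕ) where

  n last penult : ℕ
  n = suc (suc (suc k))
  last = suc (suc k)
  penult = suc k

  Γ : MultiplyLaced
  Γ = typeC n (s≤s (s≤s (s≤s z≤n)))

  open Chain Γ (nC n) (λ _ _ → refl) (if-adjacent-far _)

  nb-interior : ∀ f {m} → m ≢ penult → nb f m ≡ left f m + f (suc m)
  nb-interior f {zero}  _ = +-identityʳ (f 1)
  nb-interior f {suc m} m+1≢penult
    rewrite adjacent-pred m | adjacent-suc (suc m) | ≢⇒≡ᵇ-false (m+1≢penult ∘ cong suc)
    = cong₂ _+_ (*-identityˡ (f m)) (*-identityˡ (f (suc (suc m))))

  nb-penult : ∀ f → nb f penult ≡ f k + 2 * f last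
  nb-penult f
    rewrite adjacent-pred k | adjacent-suc (suc k) | ≢⇒≡ᵇ-false (<⇒≢ (m<n⇒m<1+n (n<1+n k))) | ≡ᵇ-refl k
    = cong (_+ 2 * f last) (*-identityˡ (f k))

  nb-rightEmpty : ∀ f m → f (suc m) ≡ 0 → nb f m ≡ left f m
  nb-rightEmpty f m r≡0 with m ≟ penult
  ... | yes refl = trans (nb-penult f) (trans (cong (λ x → f k + 2 * x) r≡0) (+-identityʳ (f k)))
  ... | no m≢pen = trans (nb-interior f m≢pen) (trans (cong (left f m +_) r≡0) (+-identityʳ (left f m)))

  nb-≤ : ∀ f m {c} → m ≢ penult → left f m ≤ c → f (suc m) ≤ c → nb f m ≤ 2 * c
  nb-≤ f m {c} m≢pen l≤c r≤c =
    subst (_≤ 2 * c) (sym (nb-interior f m≢pen)) (+-mono-≤ l≤c (m≤n⇒m≤n+o 0 r≤c))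

  m+1<last⇒m≢penult : ∀ {m} → suc m < last → m ≢ penult
  m+1<last⇒m≢penult m+1<last = <⇒≢ (s≤s⁻¹ m+1<last)

  penult<n : penult < n
  penult<n = m<n⇒m<1+n ≤-refl

  -- With α_i = e_i - e_(i+1) and α_last = 2 e_last, `interval a b` is e_a - e_b for b < n and
  -- e_a + e_last for b = n, while `doubled a b` is e_a + e_b (2 e_a if a = b): the positive roots of C_n.
  doubled : ℕ → ℕ → ℕ → ℕ
  doubled a b j = interval a n j + interval b last j

  doubled≤2 : ∀ a b j → doubled a b j ≤ 2
  doubled≤2 a b j = +-mono-≤ interval≤1 interval≤1

  doubled-beyond : ∀ a b → doubled a b n ≡ 0
  doubled-beyond a b = cong₂ _+_ (interval-above ≤-refl) (interval-above (n≤1+n last))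

  data Root : Set where
    single : ∀ a b → a < b → b ≤ n → Root
    double : ∀ a b → a ≤ b → b < last → Root

  coeffs : Root → ℕ → ℕ
  coeffs (single a b _ _) = interval a b
  coeffs (double a b _ _) = doubled a b

  coeffs-beyond : ∀ s → coeffs s n ≡ 0
  coeffs-beyond (single a b _ b≤n) = interval-above b≤n
  coeffs-beyond (double a b _ _)   = doubled-beyond a b

  extendˡ-single : ∀ {m b} → suc m < b → m ≢ penult → Fires (interval (suc m) b) m (interval m b)
  extendˡ-single {m} {b} m+1<b m≢pen =
    fires (interval-below ≤-refl)
          (trans (nb-interior _ m≢pen) (cong₂ _+_ (left-interval-below (n≤1+n m)) (interval-inside ≤-refl m+1<b)))
          (s≤s z≤n)
          (interval-inside ≤-refl (<⇒≤ m+1<b))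
          (λ j j≢m → sym (interval-extendˡ j≢m))

  extendʳ-single : ∀ {a b} → a < b → Fires (interval a b) b (interval a (suc b))
  extendʳ-single {a} {b} a<b =
    fires (interval-above ≤-refl)
          (trans (nb-rightEmpty _ b (interval-above (n≤1+n b))) (left-interval-inside a<b ≤-refl))
          (s≤s z≤n)
          (interval-inside (<⇒≤ a<b) (n<1+n b))
          (λ j j≢b → interval-extendʳ j≢b)

  last→diagonal : Fires (interval last n) penult (doubled penult penult)
  last→diagonal =
    fires (interval-below ≤-refl)
          (trans (nb-penult (interval last n))
                 (cong₂ (λ x y → x + 2 * y) (interval-below (m<n⇒m<1+n (n<1+n k)))
                                            (interval-inside ≤-refl ≤-refl)))
          (s≤s z≤n)
          (cong₂ _+_ (interval-inside ≤-refl penult<n) (interval-inside ≤-refl ≤-refl))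
          (λ j j≢pen → trans (cong₂ _+_ (sym (interval-extendˡ j≢pen)) (interval-point j≢pen)) (+-identityʳ _))

  single→double : ∀ {a} → a < penult → Fires (interval a n) penult (doubled a penult)
  single→double {a} a<pen =
    fires (interval-inside (<⇒≤ a<pen) penult<n)
          (trans (nb-penult (interval a n))
                 (cong₂ (λ x y → x + 2 * y) (interval-inside (s≤s⁻¹ a<pen) (<⇒≤ penult<n))
                                            (interval-inside (<⇒≤ (m<n⇒m<1+n a<pen)) ≤-refl)))
          (s≤s (s≤s (s≤s z≤n)))
          (cong₂ _+_ (interval-inside (<⇒≤ a<pen) penult<n) (interval-inside ≤-refl ≤-refl))
          (λ j j≢pen → trans (cong (interval a n j +_) (interval-point j≢pen)) (+-identityʳ _))

  extendˡ-double : ∀ {m b} → suc m < b → b < last → Fires (doubled (suc m) b) m (doubled m b)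
  extendˡ-double {m} {b} m+1<b b<last =
    fires (cong₂ _+_ (interval-below ≤-refl) (interval-below m<b))
          (trans (nb-interior _ (m+1<last⇒m≢penult m+1<last))
                 (cong₂ _+_ (left-+ _ _ m (left-interval-below (n≤1+n m)) (left-interval-below (<⇒≤ m<b)))
                            (cong₂ _+_ (interval-inside ≤-refl (m<n⇒m<1+n m+1<last)) (interval-below m+1<b))))
          (s≤s z≤n)
          (cong₂ _+_ (interval-inside ≤-refl (m<n⇒m<1+n (<⇒≤ m+1<last))) (interval-below m<b))
          (λ j j≢m → cong (_+ interval b last j) (sym (interval-extendˡ j≢m)))
    where
    m<b = <⇒≤ m+1<b
    m+1<last = <-trans m+1<b b<last

  extendˡ-diagonal : ∀ {m} → suc m < last → Fires (doubled (suc m) (suc m)) m (doubled m m)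
  extendˡ-diagonal {m} m+1<last =
    fires (cong₂ _+_ (interval-below ≤-refl) (interval-below ≤-refl))
          (trans (nb-interior _ (m+1<last⇒m≢penult m+1<last))
                 (cong₂ _+_ (left-+ _ _ m (left-interval-below (n≤1+n m)) (left-interval-below (n≤1+n m)))
                            (cong₂ _+_ (interval-inside ≤-refl (m<n⇒m<1+n m+1<last))
                                       (interval-inside ≤-refl m+1<last))))
          (s≤s z≤n)
          (cong₂ _+_ (interval-inside ≤-refl (m<n⇒m<1+n m<last)) (interval-inside ≤-refl m<last))
          (λ j j≢m → cong₂ _+_ (sym (interval-extendˡ j≢m)) (sym (interval-extendˡ j≢m)))
    where
    m<last = <⇒≤ m+1<last

  shrink-double : ∀ {a m} → a < m → suc m < last → Fires (doubled a (suc m)) m (doubled a m)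
  shrink-double {a} {m} a<m m+1<last =
    fires (cong₂ _+_ (interval-inside (<⇒≤ a<m) m<n) (interval-below ≤-refl))
          (trans (nb-interior _ (m+1<last⇒m≢penult m+1<last))
                 (cong₂ _+_ (left-+ _ _ m (left-interval-inside a<m (<⇒≤ m<n)) (left-interval-below (n≤1+n m)))
                            (cong₂ _+_ (interval-inside (m≤n⇒m≤1+n (<⇒≤ a<m)) (m<n⇒m<1+n m+1<last))
                                       (interval-inside ≤-refl m+1<last))))
          (s≤s (s≤s (s≤s z≤n)))
          (cong₂ _+_ (interval-inside (<⇒≤ a<m) m<n) (interval-inside ≤-refl (<⇒≤ m+1<last)))
          (λ j j≢m → cong (interval a n j +_) (sym (interval-extendˡ j≢m)))
    where
    m<n = m<n⇒m<1+n (<⇒≤ m+1<last)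

  calm-single-interior : ∀ {a b m} → a ≤ m → m < b → m ≢ penult → Calm (interval a b) m
  calm-single-interior {m = m} a≤m m<b m≢pen =
    calm-≤ (interval-inside a≤m m<b) (nb-≤ _ m m≢pen (left-≤ (λ _ → interval≤1) m) interval≤1)

  calm-single-end : ∀ {a m} → a ≤ m → Calm (interval a (suc m)) m
  calm-single-end {a} {m} a≤m =
    calm-≤ (interval-inside a≤m ≤-refl)
           (subst (_≤ 2) (sym (nb-rightEmpty _ m (interval-above ≤-refl)))
                  (≤-trans (left-≤ (λ _ → interval≤1) m) (n≤1+n 1)))

  calm-penult-single : Calm (interval penult n) penult
  calm-penult-single =
    calm-by (interval-inside ≤-refl penult<n)
            (trans (nb-penult (interval penult n))
                   (cong₂ (λ x y → x + 2 * y) (interval-below (n<1+n k)) (interval-inside (n≤1+n penult) ≤-refl)))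
            ≤-refl

  calm-double-inside : ∀ {a b m} → a ≤ m → suc m < b → b < last → Calm (doubled a b) m
  calm-double-inside {a} {b} {m} a≤m m+1<b b<last =
    calm-≤ (cong₂ _+_ (interval-inside a≤m (m<n⇒m<1+n (<⇒≤ m+1<last))) (interval-below (<⇒≤ m+1<b)))
           (nb-≤ _ m (m+1<last⇒m≢penult m+1<last) left≤1 right≤1)
    where
    m+1<last = <-trans m+1<b b<last
    left≤1 : left (doubled a b) m ≤ 1
    left≤1 = subst (_≤ 1) (sym (left-+ _ _ m refl (left-interval-below (<⇒≤ (<⇒≤ m+1<b)))))
                   (subst (_≤ 1) (sym (+-identityʳ _)) (left-≤ (λ _ → interval≤1) m))
    right≤1 : doubled a b (suc m) ≤ 1
    right≤1 = subst (_≤ 1) (sym (trans (cong (interval a n (suc m) +_) (interval-below m+1<b)) (+-identityʳ _)))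
                    interval≤1

  calm-double-first : ∀ {a} → suc a < last → Calm (doubled a (suc a)) a
  calm-double-first {a} a+1<last =
    calm-by (cong₂ _+_ (interval-inside ≤-refl (m<n⇒m<1+n (<⇒≤ a+1<last))) (interval-below ≤-refl))
            (trans (nb-interior _ (m+1<last⇒m≢penult a+1<last))
                   (cong₂ _+_ (left-+ _ _ a (left-interval-below {a} {n} ≤-refl) (left-interval-below (n≤1+n a)))
                              (cong₂ _+_ (interval-inside (n≤1+n a) (m<n⇒m<1+n a+1<last))
                                         (interval-inside ≤-refl a+1<last))))
            ≤-refl

  calm-double-tail : ∀ {a b m} → a ≤ b → b ≤ m → m < last → Calm (doubled a b) m
  calm-double-tail {a} {b} {m} a≤b b≤m m<last =
    calm-≤ (cong₂ _+_ (interval-inside (≤-trans a≤b b≤m) (m<n⇒m<1+n m<last)) (interval-inside b≤m m<last))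
           nb≤4
    where
    last≤1 : doubled a b last ≤ 1
    last≤1 = subst (_≤ 1) (sym (trans (cong (interval a n last +_) (interval-above ≤-refl)) (+-identityʳ _)))
                   interval≤1
    nb≤4 : nb (doubled a b) m ≤ 4
    nb≤4 with m ≟ penult
    ... | no m≢pen = nb-≤ _ m m≢pen (left-≤ (doubled≤2 a b) m) (doubled≤2 a b (suc m))
    ... | yes refl = subst (_≤ 4) (sym (nb-penult (doubled a b)))
                           (+-mono-≤ (doubled≤2 a b k) (*-monoʳ-≤ 2 last≤1))

  calm-double-last : ∀ {a b} → a ≤ b → b < last → Calm (doubled a b) last
  calm-double-last {a} {b} a≤b b<last =
    calm-≤ (cong₂ _+_ (interval-inside (≤-trans a≤b (<⇒≤ b<last)) ≤-refl) (interval-above ≤-refl))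
           (subst (_≤ 2) (sym (nb-rightEmpty (doubled a b) last (doubled-beyond a b))) (doubled≤2 a b penult))

  fireBefore-single : ∀ {m b} → suc m < b → b ≤ n → Σ Root λ s → Fires (interval (suc m) b) m (coeffs s)
  fireBefore-single {m} {b} m+1<b b≤n with m ≟ penult
  ... | no m≢pen = single m b (<⇒≤ m+1<b) b≤n , extendˡ-single m+1<b m≢pen
  ... | yes refl with ≤-antisym b≤n m+1<b
  ...   | refl = double penult penult ≤-refl ≤-refl , last→diagonal

  fireBefore-double : ∀ {m b} → suc m ≤ b → b < last → Σ Root λ s → Fires (doubled (suc m) b) m (coeffs s)
  fireBefore-double {m} m+1≤b b<last with m≤n⇒m<n∨m≡n m+1≤b
  ... | inj₁ m+1<b = double m _ (<⇒≤ (<⇒≤ m+1<b)) b<last , extendˡ-double m+1<b b<last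
  ... | inj₂ refl  = double m m ≤-refl (<⇒≤ b<last) , extendˡ-diagonal b<last

  calm-or-fires : ∀ s m → m < n → Calm (coeffs s) m ⊎ Σ Root λ s′ → Fires (coeffs s) m (coeffs s′)
  calm-or-fires (single a b a<b b≤n) m m<n with position a b m
  ... | before m+1<a     = inj₁ (calm-isolated (left-interval-below (<⇒≤ (<⇒≤ m+1<a))) (interval-below m+1<a))
  ... | justBefore       = inj₂ (fireBefore-single a<b b≤n)
  ... | lastInside a≤m   = inj₁ (calm-single-end a≤m)
  ... | justAfter        = inj₂ (single a (suc b) (m<n⇒m<1+n a<b) m<n , extendʳ-single a<b)
  ... | after b<m        = inj₁ (calm-isolated (left-interval-above b<m) (interval-above (m≤n⇒m≤1+n (<⇒≤ b<m))))
  ... | inside a≤m m+1<b with m ≟ penult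
  ...   | no m≢pen = inj₁ (calm-single-interior a≤m (<⇒≤ m+1<b) m≢pen)
  ...   | yes refl with ≤-antisym b≤n m+1<b | m≤n⇒m<n∨m≡n a≤m
  ...     | refl | inj₁ a<pen = inj₂ (double a penult (<⇒≤ a<pen) ≤-refl , single→double a<pen)
  ...     | refl | inj₂ refl  = inj₁ calm-penult-single
  calm-or-fires (double a b a≤b b<last) m m<n with position a b m
  ... | before m+1<a     =
    inj₁ (calm-isolated (left-+ _ _ m (left-interval-below (<⇒≤ (<⇒≤ m+1<a)))
                                      (left-interval-below (≤-trans (<⇒≤ (<⇒≤ m+1<a)) a≤b)))
                        (cong₂ _+_ (interval-below m+1<a) (interval-below (<-≤-trans m+1<a a≤b))))
  ... | justBefore       = inj₂ (fireBefore-double a≤b b<last)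
  ... | inside a≤m m+1<b = inj₁ (calm-double-inside a≤m m+1<b b<last)
  ... | justAfter        = inj₁ (calm-double-tail a≤b ≤-refl b<last)
  ... | lastInside a≤m with m≤n⇒m<n∨m≡n a≤m
  ...   | inj₁ a<m  = inj₂ (double a m (<⇒≤ a<m) (<⇒≤ b<last) , shrink-double a<m b<last)
  ...   | inj₂ refl = inj₁ (calm-double-first b<last)
  calm-or-fires (double a b a≤b b<last) m m<n | after b<m with m ≟ last
  ... | yes refl  = inj₁ (calm-double-last a≤b b<last)
  ... | no m≢last = inj₁ (calm-double-tail a≤b (<⇒≤ b<m) (≤∧≢⇒< (s≤s⁻¹ m<n) m≢last))

  top₁ top₂ : Root
  top₁ = double 0 0 z≤n (s≤s z≤n)
  top₂ = double 0 1 z≤n (s≤s (s≤s z≤n))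

  sad-or-top : ∀ s → (∃ λ m → m < n × 2 * coeffs s m < nb (coeffs s) m)
                   ⊎ (coeffs s ≗ coeffs top₁ ⊎ coeffs s ≗ coeffs top₂)
  sad-or-top (single (suc m) b m+1<b b≤n) =
    inj₁ (m , <-≤-trans (<⇒≤ m+1<b) b≤n , sad (proj₂ (fireBefore-single m+1<b b≤n)))
  sad-or-top (single zero b 0<b b≤n) with b <? n
  ... | yes b<n = inj₁ (b , b<n , sad (extendʳ-single 0<b))
  ... | no  b≮n rewrite ≤-antisym b≤n (≮⇒≥ b≮n) =
    inj₁ (penult , penult<n , sad (single→double (s≤s z≤n)))
  sad-or-top (double (suc m) b m+1≤b b<last) =
    inj₁ (m , m<n⇒m<1+n (<-≤-trans (n<1+n m) (≤-trans m+1≤b (<⇒≤ b<last))) ,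
          sad (proj₂ (fireBefore-double m+1≤b b<last)))
  sad-or-top (double zero zero _ _)       = inj₂ (inj₁ λ _ → refl)
  sad-or-top (double zero (suc zero) _ _) = inj₂ (inj₂ λ _ → refl)
  sad-or-top (double zero (suc (suc m)) _ b<last) =
    inj₁ (suc m , m<n⇒m<1+n (<⇒≤ b<last) , sad (shrink-double (s≤s z≤n) b<last))

  top₁-calm : ∀ m → m < n → Calm (coeffs top₁) m
  top₁-calm m m<n with m ≟ last
  ... | yes refl  = calm-double-last z≤n (s≤s z≤n)
  ... | no m≢last = calm-double-tail z≤n z≤n (≤∧≢⇒< (s≤s⁻¹ m<n) m≢last)

  top₂-calm : ∀ m → m < n → Calm (coeffs top₂) m
  top₂-calm zero    _ = calm-double-first (s≤s (s≤s z≤n))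
  top₂-calm (suc m) m<n with suc m ≟ last
  ... | yes m+1≡last rewrite m+1≡last = calm-double-last z≤n (s≤s (s≤s z≤n))
  ... | no m+1≢last = calm-double-tail z≤n (s≤s z≤n) (≤∧≢⇒< (s≤s⁻¹ m<n) m+1≢last)

  top₁≢top₂ : ∃ λ j → j < n × coeffs top₁ j ≢ coeffs top₂ j
  top₁≢top₂ = 0 , s≤s z≤n , λ 2≡1 → contradiction (trans (sym two) (trans 2≡1 one)) λ ()
    where
    two : doubled 0 0 0 ≡ 2
    two = cong₂ _+_ (interval-inside z≤n (s≤s z≤n)) (interval-inside z≤n (s≤s z≤n))
    one : doubled 0 1 0 ≡ 1
    one = cong₂ _+_ (interval-inside z≤n (s≤s z≤n)) (interval-below (s≤s z≤n))

  slideˡ-single : ∀ a {b} → a ≤ penult → a < b → b ≤ n → Star Step (interval a b) (interval 0 b)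
  slideˡ-single zero    _     _   _   = ε
  slideˡ-single (suc m) a≤pen a<b b≤n =
    (m , <-≤-trans (<⇒≤ a<b) b≤n , extendˡ-single a<b (<⇒≢ a≤pen)) ◅
    slideˡ-single m (<⇒≤ a≤pen) (<⇒≤ a<b) b≤n

  slideˡ-diagonal : ∀ a → a < last → Star Step (doubled a a) (doubled 0 0)
  slideˡ-diagonal zero    _      = ε
  slideˡ-diagonal (suc m) a<last =
    (m , m<n⇒m<1+n (<⇒≤ a<last) , extendˡ-diagonal a<last) ◅ slideˡ-diagonal m (<⇒≤ a<last)

  shrink-to-first : ∀ b → 0 < b → b < last → Star Step (doubled 0 b) (doubled 0 1)
  shrink-to-first (suc zero)    _ _      = ε
  shrink-to-first (suc (suc m)) _ b<last =
    (suc m , m<n⇒m<1+n (<⇒≤ b<last) , shrink-double (s≤s z≤n) b<last) ◅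
    shrink-to-first (suc m) (s≤s z≤n) (<⇒≤ b<last)

  closedFamily : ClosedFamily Γ
  closedFamily = ChainFamily.closedFamily record
    { Root          = Root
    ; coeffs        = coeffs
    ; coeffs-beyond = coeffs-beyond
    ; calm-or-fires = calm-or-fires
    ; simple        = λ m m<n → single m (suc m) ≤-refl m<n , λ _ → refl
    ; top₁          = top₁
    ; top₂          = top₂
    ; sad-or-top    = sad-or-top
    ; top₁-calm     = top₁-calm
    ; top₂-calm     = top₂-calm
    ; top₁≢top₂     = top₁≢top₂
    ; plays₁        = last , ≤-refl , doubled penult penult , (penult , penult<n , last→diagonal) ,
                      slideˡ-diagonal penult ≤-refl
    ; plays₂        = penult , penult<n , interval penult n , (last , ≤-refl , extendʳ-single ≤-refl) ,
                      slideˡ-single penult ≤-refl penult<n ≤-refl ◅◅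
                      (penult , penult<n , single→double (s≤s z≤n)) ◅ shrink-to-first penult (s≤s z≤n) ≤-refl
    }

closedFamily : (Γ : MultiplyLaced) → ClosedFamily Γ
closedFamily (typeB (suc (suc k)) (s≤s (s≤s z≤n)))             = TypeB.closedFamily k
closedFamily (typeC (suc (suc (suc k))) (s≤s (s≤s (s≤s z≤n)))) = TypeC.closedFamily k
closedFamily typeF4                                              = F₄-family
closedFamily typeG2                                              = G₂-family

mainTheorem10 : (Γ : MultiplyLaced) →
    Σ (Config Γ) λ c₁ → Σ (Config Γ) λ c₂ →
      (¬ (_≈_ {Γ} c₁ c₂))
      × (Σ (Fin (rank Γ)) λ i₀ → FinalFrom Γ i₀ c₁)
      × (Σ (Fin (rank Γ)) λ i₀ → FinalFrom Γ i₀ c₂)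
      × ((i₀ : Fin (rank Γ)) → (c : Config Γ) → FinalFrom Γ i₀ c →
           (_≈_ {Γ} c c₁) ⊎ (_≈_ {Γ} c c₂))
mainTheorem10 Γ = top₁ , top₂ , top₁≉top₂ , finalFrom₁ , finalFrom₂ , λ _ _ → finalFrom-top
  where open ClosedFamily (closedFamily Γ)
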